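{- For all integers $n,k\ge2$, $$\mathrm{spt}_{(1,0)}(n,k)=\sum_{m=1}^{\lfloor n/k\rfloor}m\sum_{\nu=1}^{k-1}p(n-km,\nu).$$
   Context: $p(n,k)$ is the number of partitions of $n$ into exactly $k$ positive parts, with the conventions $p(0,1)=1$ and $p(n,k)=0$ if $n<0$, $k<1$, or $k>n$ (so $p(0,\nu)=0$ for $\nu\ge2$). For a partition $\lambda$, $\sigma(\lambda)$ denotes its smallest part and $\#(\lambda)$ the number of parts equal to $\sigma(\lambda)$. For integers $a,b\ge 0$, $\mathrm{spt}_{(a,b)}(n,k)=\sum_{\lambda}\sigma(\lambda)^a\#(\lambda)^b$, the sum over all partitions $\lambda$ of $n$ into exactly $k$ parts; $\mathrm{spt}_{(a,b)}(n)=\sum_{k=1}^n\mathrm{spt}_{(a,b)}(n,k)$. -}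

module Defs where

open import Data.Nat using (ℕ; zero; suc; _+_; _*_; _∸_; _≤?_; _/_)
open import Data.List using (List; []; _∷_; length; map; concatMap; last)
open import Data.Nat.ListAction using (sum)
open import Data.Maybe using (Maybe; just; nothing)
open import Relation.Nullary using (yes; no)

range1 : ℕ → List ℕ
range1 zero = []
range1 (suc b) = Data.List._++_ (range1 b) (suc b ∷ [])

-- All partitions of n into exactly k positive parts, each part ≤ b,
-- represented as non-increasing lists (largest part first).
partsBounded : ℕ → ℕ → ℕ → List (List ℕ)
partsBounded zero    zero    b = [] ∷ []
partsBounded (suc n) zero    b = []
partsBounded n       (suc k) b =
  concatMap (λ a → choose a) (range1 b)
  where
    choose : ℕ → List (List ℕ)
    choose a with a ≤? n
    ... | yes _ = map (a ∷_) (partsBounded (n ∸ a) k a)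
    ... | no  _ = []

partitions : ℕ → ℕ → List (List ℕ)
partitions n k = partsBounded n k n

-- p(n,k) with the paper's conventions: p(0,1) = 1, and p(n,k) = 0 if
-- k < 1 or k > n (in particular p(0,ν) = 0 for ν ≥ 2).
p : ℕ → ℕ → ℕ
p zero (suc zero) = 1
p zero _          = 0
p n    k          = length (partitions n k)

-- smallest part σ(λ) (the last entry of the non-increasing list; 0 for the empty list)
σ : List ℕ → ℕ
σ xs with last xs
... | just x  = x
... | nothing = 0

-- spt_(1,0)(n,k) = Σ over partitions λ of n into exactly k parts of σ(λ)^1 #(λ)^0
spt10 : ℕ → ℕ → ℕ
spt10 n k = sum (map σ (partitions n k))

Σ[1,_]_ : ℕ → (ℕ → ℕ) → ℕ
Σ[1, zero  ] f = 0
Σ[1, suc N ] f = Σ[1, N ] f + f (suc N)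

-- ⌊n/k⌋ for k ≥ 1 (divisor written as suc (k ∸ 1) so no NonZero instance is needed;
-- agrees with n / k whenever k ≥ 1, which holds in the statement since k ≥ 2)
floorDiv : ℕ → ℕ → ℕ
floorDiv n k = n / suc (k ∸ 1)

{-# OPTIONS --safe #-}
-- Sort the partitions λ of n into k parts by their smallest part m, so that
-- spt(n,k) = Σ_m m · #{λ : σ(λ) = m}. Such a λ has all parts ≥ m, so none exist unless
-- km ≤ n. Subtracting m - 1 from every part and then deleting one part equal to 1 maps
-- them bijectively onto the partitions of (n - km) + (k - 1) into k - 1 parts, and
-- subtracting 1 from every part of those leaves the partitions of n - km into at most
-- k - 1 parts. There are Σ_{ν=1}^{k-1} p(n - km, ν) of them: the convention p(0,1) = 1
-- accounts for the empty partition.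

module Submission where

open import Data.List using (List; []; _∷_; _++_; map; concatMap; length)
open import Data.List.Properties using (map-++; map-∘; map-cong; concatMap-cong)
open import Data.Nat
  using (ℕ; zero; suc; _+_; _*_; _∸_; _≤_; _<_; z≤n; s≤s; s≤s⁻¹; z<s; _≤?_; _/_; NonZero)
open import Data.Nat.DivMod using (m*n/n≡m; /-monoˡ-≤; m/n≤m; m/n*n≤m)
open import Data.Nat.ListAction using (sum)
open import Data.Nat.ListAction.Properties using (sum-++)
open import Data.Nat.Properties
open import Algebra.Properties.CommutativeSemigroup +-commutativeSemigroup using (interchange)
open import Data.Sum using (inj₁; inj₂)
open import Function using (_∘_; id; const)
open import Relation.Binary.PropositionalEquality
  using (_≡_; _≢_; refl; sym; trans; cong; cong₂; subst; module ≡-Reasoning)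
open import Relation.Nullary using (yes; no; contradiction)

open import Defs

open ≡-Reasoning

m≤n<m+o⇒n∸m<o : ∀ {m n} o → m ≤ n → n < m + o → n ∸ m < o
m≤n<m+o⇒n∸m<o {m} o m≤n n<m+o = subst (_ <_) (m+n∸m≡n m o) (∸-monoˡ-< n<m+o m≤n)

∸-∸-comm : ∀ m n o → m ∸ n ∸ o ≡ m ∸ o ∸ n
∸-∸-comm m n o = begin
  m ∸ n ∸ o   ≡⟨ ∸-+-assoc m n o ⟩
  m ∸ (n + o) ≡⟨ cong (m ∸_) (+-comm n o) ⟩
  m ∸ (o + n) ≡⟨ ∸-+-assoc m o n ⟨
  m ∸ o ∸ n   ∎

n*m≤o⇒m≤o/n : ∀ m n o .{{_ : NonZero n}} → n * m ≤ o → m ≤ o / n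
n*m≤o⇒m≤o/n m n o n*m≤o =
  subst (_≤ o / n) (m*n/n≡m m n) (/-monoˡ-≤ n (subst (_≤ o) (*-comm n m) n*m≤o))

m≤o/n⇒n*m≤o : ∀ m n o .{{_ : NonZero n}} → m ≤ o / n → n * m ≤ o
m≤o/n⇒n*m≤o m n o m≤o/n =
  ≤-trans (*-monoʳ-≤ n m≤o/n) (subst (_≤ o) (*-comm (o / n) n) (m/n*n≤m o n))

infix 8 [_≤_]*_

[_≤_]*_ : ℕ → ℕ → ℕ → ℕ
[ zero  ≤ n     ]* x = x
[ suc a ≤ zero  ]* x = 0
[ suc a ≤ suc n ]* x = [ a ≤ n ]* x

[≤]*-yes : ∀ {a n} x → a ≤ n → [ a ≤ n ]* x ≡ x
[≤]*-yes {zero}          x _         = refl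
[≤]*-yes {suc a} {suc n} x (s≤s a≤n) = [≤]*-yes x a≤n

[≤]*-no : ∀ {a n} x → n < a → [ a ≤ n ]* x ≡ 0
[≤]*-no {suc a} {zero}  x _         = refl
[≤]*-no {suc a} {suc n} x (s≤s n<a) = [≤]*-no x n<a

[≤]*-≡0 : ∀ a n {x} → (a ≤ n → x ≡ 0) → [ a ≤ n ]* x ≡ 0
[≤]*-≡0 a n x≡0 with a ≤? n
... | yes a≤n = trans ([≤]*-yes _ a≤n) (x≡0 a≤n)
... | no  a≰n = [≤]*-no _ (≰⇒> a≰n)

[≤]*-+ : ∀ a n x y → [ a ≤ n ]* (x + y) ≡ [ a ≤ n ]* x + [ a ≤ n ]* y
[≤]*-+ zero    n       x y = refl
[≤]*-+ (suc a) zero    x y = refl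
[≤]*-+ (suc a) (suc n) x y = [≤]*-+ a n x y

[≤]*-* : ∀ a n c x → [ a ≤ n ]* (c * x) ≡ c * [ a ≤ n ]* x
[≤]*-* zero    n       c x = refl
[≤]*-* (suc a) zero    c x = sym (*-zeroʳ c)
[≤]*-* (suc a) (suc n) c x = [≤]*-* a n c x

[≤]*-∸ : ∀ {F G : ℕ → ℕ} a k n →
  (∀ m → k ≤ m → F m ≡ G (m ∸ k)) → (∀ m → m < k → F m ≡ 0) →
  [ suc a ≤ n ]* F (n ∸ suc a) ≡ [ suc a ≤ n ∸ k ]* G (n ∸ k ∸ suc a)
[≤]*-∸ {F} {G} a k n shift vanish with suc a + k ≤? n
... | yes fits = begin
  [ suc a ≤ n ]* F (n ∸ suc a)
    ≡⟨ [≤]*-yes _ (≤-trans (m≤m+n (suc a) k) fits) ⟩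
  F (n ∸ suc a)
    ≡⟨ shift _ (m+n≤o⇒m≤o∸n k (subst (_≤ n) (+-comm (suc a) k) fits)) ⟩
  G (n ∸ suc a ∸ k)
    ≡⟨ cong G (∸-∸-comm n (suc a) k) ⟩
  G (n ∸ k ∸ suc a)
    ≡⟨ [≤]*-yes _ (m+n≤o⇒m≤o∸n (suc a) fits) ⟨
  [ suc a ≤ n ∸ k ]* G (n ∸ k ∸ suc a) ∎
... | no overflows = trans
  ([≤]*-≡0 (suc a) n (λ a<n → vanish _ (m≤n<m+o⇒n∸m<o k a<n n<1+a+k)))
  (sym ([≤]*-no _ (s≤s (m≤n+o⇒m∸n≤o n k (subst (n ≤_) (+-comm a k) (s≤s⁻¹ n<1+a+k))))))
  where
  n<1+a+k : n < suc a + k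
  n<1+a+k = ≰⇒> overflows

δ : ℕ → ℕ → ℕ
δ zero    zero    = 1
δ zero    (suc b) = 0
δ (suc c) zero    = 0
δ (suc c) (suc b) = δ c b

δ-refl : ∀ m → δ m m ≡ 1
δ-refl zero    = refl
δ-refl (suc m) = δ-refl m

δ-≢ : ∀ m b → m ≢ b → δ m b ≡ 0
δ-≢ zero    zero    m≢b = contradiction refl m≢b
δ-≢ zero    (suc b) _   = refl
δ-≢ (suc m) zero    _   = refl
δ-≢ (suc m) (suc b) m≢b = δ-≢ m b (m≢b ∘ cong suc)

Σ-cong : ∀ N {f h : ℕ → ℕ} → (∀ i → i < N → f (suc i) ≡ h (suc i)) →
  Σ[1, N ] f ≡ Σ[1, N ] h
Σ-cong zero    eq = refl
Σ-cong (suc N) eq = cong₂ _+_ (Σ-cong N (λ i i<N → eq i (m<n⇒m<1+n i<N))) (eq N (n<1+n N))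

Σ-zero : ∀ N {f : ℕ → ℕ} → (∀ i → i < N → f (suc i) ≡ 0) → Σ[1, N ] f ≡ 0
Σ-zero zero    eq = refl
Σ-zero (suc N) eq = cong₂ _+_ (Σ-zero N (λ i i<N → eq i (m<n⇒m<1+n i<N))) (eq N (n<1+n N))

Σ-+ : ∀ N (f h : ℕ → ℕ) → Σ[1, N ] (λ i → f i + h i) ≡ Σ[1, N ] f + Σ[1, N ] h
Σ-+ zero    f h = refl
Σ-+ (suc N) f h = trans (cong (_+ (f (suc N) + h (suc N))) (Σ-+ N f h))
                        (interchange (Σ[1, N ] f) (Σ[1, N ] h) (f (suc N)) (h (suc N)))

*-distribˡ-Σ : ∀ N c (f : ℕ → ℕ) → c * Σ[1, N ] f ≡ Σ[1, N ] (λ i → c * f i)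
*-distribˡ-Σ zero    c f = *-zeroʳ c
*-distribˡ-Σ (suc N) c f = trans (*-distribˡ-+ c (Σ[1, N ] f) (f (suc N)))
                                 (cong (_+ c * f (suc N)) (*-distribˡ-Σ N c f))

Σ-comm : ∀ M N (F : ℕ → ℕ → ℕ) →
  Σ[1, M ] (λ m → Σ[1, N ] (F m)) ≡ Σ[1, N ] (λ a → Σ[1, M ] (λ m → F m a))
Σ-comm zero    N F = sym (Σ-zero N (λ _ _ → refl))
Σ-comm (suc M) N F = trans (cong (_+ Σ[1, N ] (F (suc M))) (Σ-comm M N F))
                           (sym (Σ-+ N (λ a → Σ[1, M ] (λ m → F m a)) (F (suc M))))

Σ-peel : ∀ N (f : ℕ → ℕ) → Σ[1, suc N ] f ≡ f 1 + Σ[1, N ] (f ∘ suc)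
Σ-peel zero    f = +-comm 0 (f 1)
Σ-peel (suc N) f = trans (cong (_+ f (suc (suc N))) (Σ-peel N f)) (+-assoc (f 1) _ _)

Σ-truncate : ∀ N M {f : ℕ → ℕ} → N ≤ M → (∀ i → N ≤ i → i < M → f (suc i) ≡ 0) →
  Σ[1, M ] f ≡ Σ[1, N ] f
Σ-truncate N zero    z≤n   _      = refl
Σ-truncate N (suc M) N≤1+M vanish with m≤n⇒m<n∨m≡n N≤1+M
... | inj₂ refl      = refl
... | inj₁ (s≤s N≤M) = trans
  (cong₂ _+_ (Σ-truncate N M N≤M (λ i N≤i i<M → vanish i N≤i (m<n⇒m<1+n i<M)))
             (vanish M N≤M (n<1+n M)))
  (+-identityʳ _)

[≤]*-Σ : ∀ a n N (f : ℕ → ℕ) → [ a ≤ n ]* Σ[1, N ] f ≡ Σ[1, N ] (λ i → [ a ≤ n ]* f i)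
[≤]*-Σ a n zero    f = [≤]*-≡0 a n (λ _ → refl)
[≤]*-Σ a n (suc N) f = trans ([≤]*-+ a n _ _) (cong (_+ [ a ≤ n ]* f (suc N)) ([≤]*-Σ a n N f))

Σ-δ : ∀ (f : ℕ → ℕ) M b → 0 < b → b ≤ M → Σ[1, M ] (λ m → f m * δ m b) ≡ f b
Σ-δ f zero    (suc b) _   ()
Σ-δ f (suc M) b       0<b b≤1+M with m≤n⇒m<n∨m≡n b≤1+M
... | inj₁ (s≤s b≤M) = begin
  Σ[1, M ] (λ m → f m * δ m b) + f (suc M) * δ (suc M) b
    ≡⟨ cong₂ _+_ (Σ-δ f M b 0<b b≤M) (cong (f (suc M) *_) (δ-≢ (suc M) b (>⇒≢ (s≤s b≤M)))) ⟩
  f b + f (suc M) * 0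
    ≡⟨ cong (f b +_) (*-zeroʳ (f (suc M))) ⟩
  f b + 0
    ≡⟨ +-identityʳ (f b) ⟩
  f b ∎
... | inj₂ refl = begin
  Σ[1, M ] (λ m → f m * δ m (suc M)) + f (suc M) * δ (suc M) (suc M)
    ≡⟨ cong₂ _+_ (Σ-zero M earlier) (cong (f (suc M) *_) (δ-refl (suc M))) ⟩
  0 + f (suc M) * 1
    ≡⟨ *-identityʳ (f (suc M)) ⟩
  f (suc M) ∎
  where
  earlier : ∀ i → i < M → f (suc i) * δ (suc i) (suc M) ≡ 0
  earlier i i<M =
    trans (cong (f (suc i) *_) (δ-≢ (suc i) (suc M) (<⇒≢ (s≤s i<M)))) (*-zeroʳ (f (suc i)))

-- W β n k b sums β (smallest part) over the partitions of n into k parts of size at most b.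
-- For k = 0 the bound b plays the role of the last part chosen, so that the recursion
-- mirrors partsBounded.
W : (ℕ → ℕ) → ℕ → ℕ → ℕ → ℕ
W β n       (suc k) b = Σ[1, b ] (λ a → [ a ≤ n ]* W β (n ∸ a) k a)
W β zero    zero    b = β b
W β (suc n) zero    b = 0

sum-map-concatMap : ∀ {A B : Set} (h : B → ℕ) (f : A → List B) xs →
  sum (map h (concatMap f xs)) ≡ sum (map (sum ∘ map h ∘ f) xs)
sum-map-concatMap h f []       = refl
sum-map-concatMap h f (x ∷ xs) = begin
  sum (map h (f x ++ concatMap f xs))
    ≡⟨ cong sum (map-++ h (f x) _) ⟩
  sum (map h (f x) ++ map h (concatMap f xs))
    ≡⟨ sum-++ (map h (f x)) _ ⟩
  sum (map h (f x)) + sum (map h (concatMap f xs))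
    ≡⟨ cong (sum (map h (f x)) +_) (sum-map-concatMap h f xs) ⟩
  sum (map h (f x)) + sum (map (sum ∘ map h ∘ f) xs) ∎

sum-map-range1 : ∀ (f : ℕ → ℕ) b → sum (map f (range1 b)) ≡ Σ[1, b ] f
sum-map-range1 f zero    = refl
sum-map-range1 f (suc b) = begin
  sum (map f (range1 b ++ suc b ∷ []))
    ≡⟨ cong sum (map-++ f (range1 b) _) ⟩
  sum (map f (range1 b) ++ f (suc b) ∷ [])
    ≡⟨ sum-++ (map f (range1 b)) _ ⟩
  sum (map f (range1 b)) + (f (suc b) + 0)
    ≡⟨ cong₂ _+_ (sum-map-range1 f b) (+-identityʳ (f (suc b))) ⟩
  Σ[1, b ] f + f (suc b) ∎

branch : ℕ → ℕ → ℕ → List (List ℕ)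
branch n k a with a ≤? n
... | yes _ = map (a ∷_) (partsBounded (n ∸ a) k a)
... | no  _ = []

-- The left-hand sides are the local function of partsBounded, which cannot be named
-- here; they are inferred from the use in partsBounded-suc.
choose₀≡branch  : ∀ k b a → _ ≡ branch zero k a
choose₁₊≡branch : ∀ n k b a → _ ≡ branch (suc n) k a

partsBounded-suc : ∀ n k b → partsBounded n (suc k) b ≡ concatMap (branch n k) (range1 b)
partsBounded-suc zero    k b = concatMap-cong (choose₀≡branch k b) (range1 b)
partsBounded-suc (suc n) k b = concatMap-cong (choose₁₊≡branch n k b) (range1 b)

choose₀≡branch k b a with a ≤? zero
... | yes _ = refl
... | no  _ = refl

choose₁₊≡branch n k b a with a ≤? suc n
... | yes _ = refl
... | no  _ = refl

sum-map-branch : ∀ (h : List ℕ → ℕ) n k a →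
  sum (map h (branch n k a)) ≡ [ a ≤ n ]* sum (map (h ∘ (a ∷_)) (partsBounded (n ∸ a) k a))
sum-map-branch h n k a with a ≤? n
... | yes a≤n = trans (cong sum (sym (map-∘ (partsBounded (n ∸ a) k a)))) (sym ([≤]*-yes _ a≤n))
... | no  a≰n = sym ([≤]*-no _ (≰⇒> a≰n))

sum-map-partsBounded-suc : ∀ (h : List ℕ → ℕ) n k b → sum (map h (partsBounded n (suc k) b)) ≡
  Σ[1, b ] (λ a → [ a ≤ n ]* sum (map (h ∘ (a ∷_)) (partsBounded (n ∸ a) k a)))
sum-map-partsBounded-suc h n k b = begin
  sum (map h (partsBounded n (suc k) b))
    ≡⟨ cong (sum ∘ map h) (partsBounded-suc n k b) ⟩
  sum (map h (concatMap (branch n k) (range1 b)))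
    ≡⟨ sum-map-concatMap h (branch n k) (range1 b) ⟩
  sum (map (sum ∘ map h ∘ branch n k) (range1 b))
    ≡⟨ cong sum (map-cong (sum-map-branch h n k) (range1 b)) ⟩
  sum (map (λ a → [ a ≤ n ]* sum (map (h ∘ (a ∷_)) (partsBounded (n ∸ a) k a))) (range1 b))
    ≡⟨ sum-map-range1 _ b ⟩
  Σ[1, b ] (λ a → [ a ≤ n ]* sum (map (h ∘ (a ∷_)) (partsBounded (n ∸ a) k a))) ∎

sum-map-partsBounded : ∀ β k n b → sum (map (β ∘ σ ∘ (b ∷_)) (partsBounded n k b)) ≡ W β n k b
sum-map-partsBounded β zero    zero    b = +-identityʳ (β b)
sum-map-partsBounded β zero    (suc n) b = refl
sum-map-partsBounded β (suc k) n       b = trans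
  (sum-map-partsBounded-suc (β ∘ σ ∘ (b ∷_)) n k b)
  (Σ-cong b (λ i _ → cong ([ suc i ≤ n ]*_) (sum-map-partsBounded β k (n ∸ suc i) (suc i))))

spt10≡W : ∀ n k → spt10 n (suc k) ≡ W id n (suc k) n
spt10≡W n k = trans
  (sum-map-partsBounded-suc σ n k n)
  (Σ-cong n (λ i _ → cong ([ suc i ≤ n ]*_) (sum-map-partsBounded id k (n ∸ suc i) (suc i))))

length-partsBounded : ∀ n k b → length (partsBounded n k b) ≡ W (const 1) n k b
length-partsBounded n k b =
  trans (length≡sum-map-1 (partsBounded n k b)) (sum-map-partsBounded (const 1) k n b)
  where
  length≡sum-map-1 : ∀ {A : Set} (xs : List A) → length xs ≡ sum (map (const 1) xs)
  length≡sum-map-1 []       = refl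
  length≡sum-map-1 (x ∷ xs) = cong suc (length≡sum-map-1 xs)

W-+ : ∀ β β′ k n b → W (λ x → β x + β′ x) n k b ≡ W β n k b + W β′ n k b
W-+ β β′ zero    zero    b = refl
W-+ β β′ zero    (suc n) b = refl
W-+ β β′ (suc k) n       b = trans
  (Σ-cong b (λ i _ → trans (cong ([ suc i ≤ n ]*_) (W-+ β β′ k (n ∸ suc i) (suc i)))
                           ([≤]*-+ (suc i) n _ _)))
  (Σ-+ b (λ a → [ a ≤ n ]* W β (n ∸ a) k a) (λ a → [ a ≤ n ]* W β′ (n ∸ a) k a))

W-cong : ∀ {β β′} k n b → (∀ x → x < b → β (suc x) ≡ β′ (suc x)) →
  W β n (suc k) b ≡ W β′ n (suc k) b
W-cong {β} {β′} zero n b eq =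
  Σ-cong b (λ i i<b → cong ([ suc i ≤ n ]*_) (single (n ∸ suc i) (eq i i<b)))
  where
  single : ∀ {a} m → β a ≡ β′ a → W β m 0 a ≡ W β′ m 0 a
  single zero    βa≡β′a = βa≡β′a
  single (suc m) _      = refl
W-cong (suc k) n b eq = Σ-cong b (λ i i<b →
  cong ([ suc i ≤ n ]*_) (W-cong k (n ∸ suc i) (suc i) (λ x x<1+i → eq x (<-≤-trans x<1+i i<b))))

W-large-bound : ∀ {β} k n b → n ≤ b → W β n (suc k) b ≡ W β n (suc k) n
W-large-bound k n b n≤b = Σ-truncate n b n≤b (λ i n≤i _ → [≤]*-no _ (s≤s n≤i))

W-by-smallest : ∀ β k n b M → 0 < b → b ≤ M →
  W β n k b ≡ Σ[1, M ] (λ m → β m * W (δ m) n k b)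
W-by-smallest β zero    zero    b M 0<b b≤M = sym (Σ-δ β M b 0<b b≤M)
W-by-smallest β zero    (suc n) b M _   _   = sym (Σ-zero M (λ m _ → *-zeroʳ (β (suc m))))
W-by-smallest β (suc k) n       b M _   b≤M = begin
  Σ[1, b ] (λ a → [ a ≤ n ]* W β (n ∸ a) k a)
    ≡⟨ Σ-cong b (λ i i<b → cong ([ suc i ≤ n ]*_)
         (W-by-smallest β k (n ∸ suc i) (suc i) M z<s (≤-trans i<b b≤M))) ⟩
  Σ[1, b ] (λ a → [ a ≤ n ]* Σ[1, M ] (λ m → β m * W (δ m) (n ∸ a) k a))
    ≡⟨ Σ-cong b (λ i _ → trans ([≤]*-Σ (suc i) n M _)
         (Σ-cong M (λ m _ → [≤]*-* (suc i) n (β (suc m)) _))) ⟩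
  Σ[1, b ] (λ a → Σ[1, M ] (λ m → β m * [ a ≤ n ]* W (δ m) (n ∸ a) k a))
    ≡⟨ Σ-comm b M _ ⟩
  Σ[1, M ] (λ m → Σ[1, b ] (λ a → β m * [ a ≤ n ]* W (δ m) (n ∸ a) k a))
    ≡⟨ Σ-cong M (λ m _ → *-distribˡ-Σ b (β (suc m)) _) ⟨
  Σ[1, M ] (λ m → β m * W (δ m) n (suc k) b) ∎

n<k⇒W≡0 : ∀ {β} k n b → n < k → W β n k b ≡ 0
n<k⇒W≡0 (suc k) n b n<1+k = Σ-zero b (λ i _ → [≤]*-≡0 (suc i) n (λ 1+i≤n →
  n<k⇒W≡0 k (n ∸ suc i) (suc i) (m≤n<m+o⇒n∸m<o k 1+i≤n (≤-trans n<1+k (s≤s (m≤n+m k i))))))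

W-bound-1 : ∀ {β} → β 1 ≡ 0 → ∀ k n → W β n k 1 ≡ 0
W-bound-1 β1≡0 zero    zero    = β1≡0
W-bound-1 β1≡0 zero    (suc n) = refl
W-bound-1 β1≡0 (suc k) n       = [≤]*-≡0 1 n (λ _ → W-bound-1 β1≡0 k (n ∸ 1))

b<c⇒W-δ≡0 : ∀ c k n b → b < c → W (δ c) n k b ≡ 0
b<c⇒W-δ≡0 c zero    zero    b b<c = δ-≢ c b (>⇒≢ b<c)
b<c⇒W-δ≡0 c zero    (suc n) b _   = refl
b<c⇒W-δ≡0 c (suc k) n       b b<c = Σ-zero b (λ i i<b → [≤]*-≡0 (suc i) n (λ _ →
  b<c⇒W-δ≡0 c k (n ∸ suc i) (suc i) (≤-<-trans i<b b<c)))

n<k*c⇒W-δ≡0 : ∀ c k n b → n < k * c → W (δ c) n k b ≡ 0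
n<k*c⇒W-δ≡0 c (suc k) n b n<c+k*c = Σ-zero b (λ i _ → [≤]*-≡0 (suc i) n (rest i))
  where
  rest : ∀ i → suc i ≤ n → W (δ c) (n ∸ suc i) k (suc i) ≡ 0
  rest i 1+i≤n with c ≤? suc i
  ... | yes c≤1+i = n<k*c⇒W-δ≡0 c k (n ∸ suc i) (suc i) (m≤n<m+o⇒n∸m<o (k * c) 1+i≤n
                      (<-≤-trans n<c+k*c (+-monoˡ-≤ (k * c) c≤1+i)))
  ... | no  c≰1+i = b<c⇒W-δ≡0 c k (n ∸ suc i) (suc i) (≰⇒> c≰1+i)

-- Subtracting 1 from every part: parts equal to 1 would become 0, which β 1 ≡ 0 discards.
W-shift : ∀ {β} → β 0 ≡ 0 → β 1 ≡ 0 → ∀ k n b → k ≤ n →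
  W β n k b ≡ W (β ∘ suc) (n ∸ k) k (b ∸ 1)
W-shift β0≡0 β1≡0 zero    zero    zero    _ = trans β0≡0 (sym β1≡0)
W-shift β0≡0 β1≡0 zero    zero    (suc b) _ = refl
W-shift β0≡0 β1≡0 zero    (suc n) b       _ = refl
W-shift β0≡0 β1≡0 (suc k) (suc n) zero    _ = refl
W-shift {β} β0≡0 β1≡0 (suc k) (suc n) (suc b) (s≤s k≤n) = begin
  W β (suc n) (suc k) (suc b)
    ≡⟨ Σ-peel b _ ⟩
  W β n k 1 + Σ[1, b ] (λ a → [ a ≤ n ]* W β (n ∸ a) k (suc a))
    ≡⟨ cong₂ _+_ (W-bound-1 β1≡0 k n) (Σ-cong b (λ i _ →
         [≤]*-∸ {G = λ m → W (β ∘ suc) m k (suc i)} i k n (shifted i) (λ m → n<k⇒W≡0 k m _))) ⟩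
  W (β ∘ suc) (n ∸ k) (suc k) b ∎
  where
  shifted : ∀ i m → k ≤ m → W β m k (suc (suc i)) ≡ W (β ∘ suc) (m ∸ k) k (suc i)
  shifted i m = W-shift β0≡0 β1≡0 k m (suc (suc i))

W-δ-shift : ∀ j k n b → k * j ≤ n → W (δ (suc j)) n k b ≡ W (δ 1) (n ∸ k * j) k (b ∸ j)
W-δ-shift zero    k n b _ = cong (λ x → W (δ 1) (n ∸ x) k b) (sym (*-zeroʳ k))
W-δ-shift (suc j) k n b k*[1+j]≤n = begin
  W (δ (suc (suc j))) n k b
    ≡⟨ W-shift refl refl k n b (m+n≤o⇒m≤o k k+k*j≤n) ⟩
  W (δ (suc j)) (n ∸ k) k (b ∸ 1)
    ≡⟨ W-δ-shift j k (n ∸ k) (b ∸ 1) k*j≤n∸k ⟩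
  W (δ 1) (n ∸ k ∸ k * j) k (b ∸ 1 ∸ j)
    ≡⟨ cong₂ (λ x y → W (δ 1) x k y) n∸k∸k*j≡n∸k*[1+j] (∸-+-assoc b 1 j) ⟩
  W (δ 1) (n ∸ k * suc j) k (b ∸ suc j) ∎
  where
  k+k*j≤n : k + k * j ≤ n
  k+k*j≤n = subst (_≤ n) (*-suc k j) k*[1+j]≤n
  k*j≤n∸k : k * j ≤ n ∸ k
  k*j≤n∸k = m+n≤o⇒m≤o∸n (k * j) (subst (_≤ n) (+-comm k (k * j)) k+k*j≤n)
  n∸k∸k*j≡n∸k*[1+j] : n ∸ k ∸ k * j ≡ n ∸ k * suc j
  n∸k∸k*j≡n∸k*[1+j] = trans (∸-+-assoc n k (k * j)) (cong (n ∸_) (sym (*-suc k j)))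

W-δ1 : ∀ k n b → 0 < b → W (δ 1) (suc n) (suc k) b ≡ W (const 1) n k b
W-δ1 zero n (suc b) _ = begin
  W (δ 1) (suc n) 1 (suc b)
    ≡⟨ Σ-peel b _ ⟩
  W (δ 1) n 0 1 + Σ[1, b ] (λ a → [ a ≤ n ]* W (δ 1) (n ∸ a) 0 (suc a))
    ≡⟨ cong₂ _+_ (lone n) (Σ-zero b (λ i _ → [≤]*-≡0 (suc i) n (λ _ → wide (n ∸ suc i) i))) ⟩
  W (const 1) n 0 (suc b) + 0
    ≡⟨ +-identityʳ _ ⟩
  W (const 1) n 0 (suc b) ∎
  where
  lone : ∀ m → W (δ 1) m 0 1 ≡ W (const 1) m 0 (suc b)
  lone zero    = refl
  lone (suc m) = refl
  wide : ∀ m i → W (δ 1) m 0 (suc (suc i)) ≡ 0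
  wide zero    i = refl
  wide (suc m) i = refl
W-δ1 (suc k) n b _ = Σ-cong b (λ i _ →
  [≤]*-∸ {G = λ m → W (const 1) m k (suc i)} i 1 (suc n) (peel i)
         (λ m m<1 → n<k⇒W≡0 (suc k) m (suc i) (<-≤-trans m<1 (s≤s z≤n))))
  where
  peel : ∀ i m → 1 ≤ m → W (δ 1) m (suc k) (suc i) ≡ W (const 1) (m ∸ 1) k (suc i)
  peel i (suc m) _ = W-δ1 k m (suc i) z<s

-- P N ν counts the partitions of N into ν parts; unlike p, it has P 0 0 = 1 and P 0 1 = 0.
P : ℕ → ℕ → ℕ
P N ν = W (const 1) N ν N

P≤ : ℕ → ℕ → ℕ
P≤ N k = P N 0 + Σ[1, k ] (P N)

-- Split by whether the smallest part is 1 (delete it) or not (subtract 1 from every part):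
-- this is the recurrence p(N + k, k) = p(N + k - 1, k - 1) + p(N, k).
W-const1-+ : ∀ k N B → N + k ≤ B → W (const 1) (N + k) k B ≡ P≤ N k
W-const1-+ zero N B _ = begin
  W (const 1) (N + 0) 0 B ≡⟨ cong (λ x → W (const 1) x 0 B) (+-identityʳ N) ⟩
  W (const 1) N 0 B       ≡⟨ bound-irrelevant N ⟩
  P N 0                   ≡⟨ +-identityʳ (P N 0) ⟨
  P≤ N 0                  ∎
  where
  bound-irrelevant : ∀ N → W (const 1) N 0 B ≡ W (const 1) N 0 N
  bound-irrelevant zero    = refl
  bound-irrelevant (suc N) = refl
W-const1-+ (suc k) N B N+1+k≤B = begin
  W (const 1) (N + suc k) (suc k) B
    ≡⟨ cong (λ x → W (const 1) x (suc k) B) (+-suc N k) ⟩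
  W (const 1) (suc (N + k)) (suc k) B
    ≡⟨ W-cong k _ B (λ x _ → one-split x) ⟩
  W (λ x → δ 1 x + [ 2 ≤ x ]* 1) (suc (N + k)) (suc k) B
    ≡⟨ W-+ (δ 1) ([ 2 ≤_]* 1) (suc k) _ B ⟩
  W (δ 1) (suc (N + k)) (suc k) B + W ([ 2 ≤_]* 1) (suc (N + k)) (suc k) B
    ≡⟨ cong₂ _+_ (W-δ1 k (N + k) B (<-≤-trans z<s N+k<B))
                 (W-shift refl refl (suc k) _ B (s≤s (m≤n+m k N))) ⟩
  W (const 1) (N + k) k B + W ([ 1 ≤_]* 1) (N + k ∸ k) (suc k) (B ∸ 1)
    ≡⟨ cong₂ _+_ (W-const1-+ k N B (<⇒≤ N+k<B))
                 (cong (λ x → W ([ 1 ≤_]* 1) x (suc k) (B ∸ 1)) (m+n∸n≡m N k)) ⟩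
  P≤ N k + W ([ 1 ≤_]* 1) N (suc k) (B ∸ 1)
    ≡⟨ cong (P≤ N k +_) (W-cong k N (B ∸ 1) (λ _ _ → refl)) ⟩
  P≤ N k + W (const 1) N (suc k) (B ∸ 1)
    ≡⟨ cong (P≤ N k +_) (W-large-bound k N (B ∸ 1) N≤B∸1) ⟩
  P≤ N k + P N (suc k)
    ≡⟨ +-assoc (P N 0) (Σ[1, k ] (P N)) (P N (suc k)) ⟩
  P≤ N (suc k) ∎
  where
  one-split : ∀ x → 1 ≡ δ 1 (suc x) + [ 2 ≤ suc x ]* 1
  one-split zero    = refl
  one-split (suc x) = refl
  N+k<B : N + k < B
  N+k<B = subst (_≤ B) (+-suc N k) N+1+k≤B
  N≤B∸1 : N ≤ B ∸ 1
  N≤B∸1 = m+n≤o⇒m≤o∸n N (subst (_≤ B) (+-comm 1 N) (≤-trans (s≤s (m≤m+n N k)) N+k<B))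

W-δ≡P≤ : ∀ k n j → suc k * suc j ≤ n → W (δ (suc j)) n (suc k) n ≡ P≤ (n ∸ suc k * suc j) k
W-δ≡P≤ k n j fits = begin
  W (δ (suc j)) n K n             ≡⟨ W-δ-shift j K n n (≤-trans (*-monoʳ-≤ K (n≤1+n j)) fits) ⟩
  W (δ 1) (n ∸ K * j) K (n ∸ j)   ≡⟨ cong (λ x → W (δ 1) x K (n ∸ j)) n∸K*j≡1+N+k ⟩
  W (δ 1) (suc (N + k)) K (n ∸ j) ≡⟨ W-δ1 k (N + k) (n ∸ j) (<-≤-trans z<s N+k<n∸j) ⟩
  W (const 1) (N + k) k (n ∸ j)   ≡⟨ W-const1-+ k N (n ∸ j) (<⇒≤ N+k<n∸j) ⟩
  P≤ N k                          ∎
  where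
  K = suc k
  N = n ∸ K * suc j
  n∸K*j≡1+N+k : n ∸ K * j ≡ suc (N + k)
  n∸K*j≡1+N+k = begin
    n ∸ K * j               ≡⟨ cong (_∸ K * j) (m∸n+n≡m fits) ⟨
    N + K * suc j ∸ K * j   ≡⟨ cong (λ x → N + x ∸ K * j) (*-suc K j) ⟩
    N + (K + K * j) ∸ K * j ≡⟨ cong (_∸ K * j) (+-assoc N K (K * j)) ⟨
    N + K + K * j ∸ K * j   ≡⟨ m+n∸n≡m (N + K) (K * j) ⟩
    N + K                   ≡⟨ +-suc N k ⟩
    suc (N + k)             ∎
  N+k<n∸j : N + k < n ∸ j
  N+k<n∸j = subst (_≤ n ∸ j) n∸K*j≡1+N+k (∸-monoʳ-≤ n (m≤n*m j K))

Σp≡P≤ : ∀ N k → Σ[1, suc k ] (p N) ≡ P≤ N (suc k)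
Σp≡P≤ zero    k = trans (Σ-peel k (p 0))
  (cong (1 +_) (trans (Σ-zero k (λ _ _ → refl)) (sym (Σ-zero (suc k) (λ _ _ → refl)))))
Σp≡P≤ (suc N) k = Σ-cong (suc k) (λ ν _ → length-partsBounded (suc N) (suc ν) (suc N))

lemma5 : (n k : ℕ) → 2 ≤ n → 2 ≤ k →
    spt10 n k ≡ Σ[1, floorDiv n k ] (λ m → m * Σ[1, k ∸ 1 ] (λ ν → p (n ∸ k * m) ν))
lemma5 n (suc zero) _ (s≤s ())
lemma5 n k@(suc (suc k′)) 2≤n _ = begin
  spt10 n k
    ≡⟨ spt10≡W n (suc k′) ⟩
  W id n k n
    ≡⟨ W-by-smallest id k n n n (≤-trans (s≤s z≤n) 2≤n) ≤-refl ⟩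
  Σ[1, n ] (λ m → m * W (δ m) n k n)
    ≡⟨ Σ-truncate (n / k) n (m/n≤m n k) beyond ⟩
  Σ[1, n / k ] (λ m → m * W (δ m) n k n)
    ≡⟨ Σ-cong (n / k) (λ j j<n/k → cong (suc j *_) (count j j<n/k)) ⟩
  Σ[1, n / k ] (λ m → m * Σ[1, suc k′ ] (p (n ∸ k * m))) ∎
  where
  count : ∀ j → j < n / k → W (δ (suc j)) n k n ≡ Σ[1, suc k′ ] (p (n ∸ k * suc j))
  count j j<n/k = trans (W-δ≡P≤ (suc k′) n j (m≤o/n⇒n*m≤o (suc j) k n j<n/k))
                        (sym (Σp≡P≤ (n ∸ k * suc j) k′))
  beyond : ∀ i → n / k ≤ i → i < n → suc i * W (δ (suc i)) n k n ≡ 0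
  beyond i n/k≤i _ = trans
    (cong (suc i *_) (n<k*c⇒W-δ≡0 (suc i) k n n
      (≰⇒> (λ fits → ≤⇒≯ n/k≤i (n*m≤o⇒m≤o/n (suc i) k n fits)))))
    (*-zeroʳ (suc i))
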